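{- Let $n$ and $k$ be integers with $4\leq k\leq n$ and $k$ even, and let $M\subseteq E(K_n)$ be an edge set such that $\Delta(K_n[M])\geq \frac{k}{2}+1$. Then $\kappa_k(K_n\setminus M)\leq \lambda_k(K_n\setminus M)< n-\frac{k}{2}-1$.
   Context: For a graph $G$ and $S\subseteq V(G)$ with $|S|\geq 2$, an $S$-tree is a subgraph of $G$ that is a tree containing all vertices of $S$. Two $S$-trees $T,T'$ are internally disjoint if $E(T)\cap E(T')=\varnothing$ and $V(T)\cap V(T')=S$. $\kappa(S)$ (resp. $\lambda(S)$) is the maximum number of pairwise internally disjoint (resp. edge-disjoint) $S$-trees in $G$; $\kappa_k(G)=\min\{\kappa(S):|S|=k\}$ and $\lambda_k(G)=\min\{\lambda(S):|S|=k\}$, both set to $0$ if $G$ is disconnected. $K_n\setminus M$ is $K_n$ with the edges of $M$ deleted, $K_n[M]$ is the subgraph of $K_n$ induced by the edge set $M$, and $\Delta$ denotes maximum degree. -}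

module Defs where

open import Data.Nat using (ℕ; zero; suc; _+_; _*_; _∸_; _≤_; _<_; _/_)
open import Data.Nat.Divisibility using (_∣_)
open import Data.Fin using (Fin; zero; suc; inject₁; fromℕ)
open import Data.Fin.Subset using (Subset; _∈_; _⊆_; ∣_∣)
open import Data.Product using (Σ; ∃; ∃-syntax; _×_; _,_)
open import Data.Sum using (_⊎_)
open import Data.Empty using (⊥)
open import Relation.Nullary using (¬_)
open import Relation.Binary.PropositionalEquality using (_≡_; _≢_)
open import Function.Definitions using (Injective)

Graph : ℕ → Set₁
Graph n = Fin n → Fin n → Set

-- An edge set M ⊆ E(K_n) is given by a relation M on Fin n; the edge {u,v}
-- (u ≢ v) belongs to M iff  M u v ⊎ M v u.  Every edge set arises this way.
EdgeSet : ℕ → Set₁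
EdgeSet n = Fin n → Fin n → Set

InM : ∀ {n} → EdgeSet n → Fin n → Fin n → Set
InM M u v = u ≢ v × (M u v ⊎ M v u)

KnMinus : ∀ n → EdgeSet n → Graph n
KnMinus n M u v = u ≢ v × ¬ (M u v ⊎ M v u)

-- Δ(K_n[M]) ≥ d : some vertex has at least d distinct M-neighbours
-- (vertices of K_n[M] are exactly the endpoints of edges of M, so every
-- vertex of positive degree lies in K_n[M]; for d ≥ 1 this is exact).
MaxDegAtLeast : ∀ {n} → EdgeSet n → ℕ → Set
MaxDegAtLeast {n} M d =
  ∃[ v ] Σ (Fin d → Fin n) λ f → Injective _≡_ _≡_ f × (∀ i → InM M v (f i))

data Reach {n} (R : Fin n → Fin n → Set) : Fin n → Fin n → Set where
  here : ∀ {u} → Reach R u u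
  step : ∀ {u v w} → R u v → Reach R v w → Reach R u w

Connected : ∀ {n} → Graph n → Set
Connected {n} G = ∀ (u v : Fin n) → Reach G u v

HasCycle : ∀ {n} → (Fin n → Fin n → Set) → Set
HasCycle {n} E =
  Σ ℕ λ L → 2 ≤ L × Σ (Fin (suc L) → Fin n) λ c →
    Injective _≡_ _≡_ c
    × (∀ (i : Fin L) → E (c (inject₁ i)) (c (suc i)))
    × E (c (fromℕ L)) (c zero)

record Subgraph {n} (G : Graph n) : Set₁ where
  field
    V    : Subset n
    E    : Fin n → Fin n → Set
    sym  : ∀ {u v} → E u v → E v u
    inG  : ∀ {u v} → E u v → G u v
    endˡ : ∀ {u v} → E u v → u ∈ V
open Subgraph public

IsTree : ∀ {n} {G : Graph n} → Subgraph G → Set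
IsTree T = (∀ {u v} → u ∈ V T → v ∈ V T → Reach (E T) u v) × ¬ HasCycle (E T)

record STree {n} (G : Graph n) (S : Subset n) : Set₁ where
  field
    tree   : Subgraph G
    isTree : IsTree tree
    spans  : S ⊆ V tree
open STree public

EdgeDisjoint : ∀ {n} {G : Graph n} {S} → STree G S → STree G S → Set
EdgeDisjoint T T' = ∀ u v → E (tree T) u v → E (tree T') u v → ⊥

-- V(T) ∩ V(T') = S  (S ⊆ both holds by definition of S-tree)
InternallyDisjoint : ∀ {n} {G : Graph n} {S} → STree G S → STree G S → Set
InternallyDisjoint {S = S} T T' =
  EdgeDisjoint T T' × (∀ v → v ∈ V (tree T) → v ∈ V (tree T') → v ∈ S)

KappaS≥ : ∀ {n} → Graph n → Subset n → ℕ → Set₁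
KappaS≥ G S t = Σ (Fin t → STree G S) λ T →
  ∀ i j → i ≢ j → InternallyDisjoint (T i) (T j)

LambdaS≥ : ∀ {n} → Graph n → Subset n → ℕ → Set₁
LambdaS≥ G S t = Σ (Fin t → STree G S) λ T →
  ∀ i j → i ≢ j → EdgeDisjoint (T i) (T j)

-- κ_k(G) ≥ t   (κ_k(G) = 0 when G is disconnected)
Kappa_k≥ : ∀ {n} → Graph n → ℕ → ℕ → Set₁
Kappa_k≥ {n} G k t = (t ≡ 0 → ⊥) → Connected G × (∀ (S : Subset n) → ∣ S ∣ ≡ k → KappaS≥ G S t)

Lambda_k≥ : ∀ {n} → Graph n → ℕ → ℕ → Set₁
Lambda_k≥ {n} G k t = (t ≡ 0 → ⊥) → Connected G × (∀ (S : Subset n) → ∣ S ∣ ≡ k → LambdaS≥ G S t)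

-- The vertex v of maximum M-degree d lies in some k-set S together with a second
-- vertex u.  Each of t edge-disjoint S-trees joins v to u, so it uses an edge at v,
-- and these t edges are distinct; their far ends are neighbours of v in K_n ∖ M,
-- hence distinct from v and from its d neighbours in M.  So 1 + d + t ≤ n, i.e.
-- λ_k(K_n ∖ M) ≤ n − 1 − Δ(K_n[M]); with d = k/2 + 1 this is below n − k/2 − 1.
module Submission where

open import Defs
open import Data.Nat using (ℕ; zero; suc; _+_; _*_; _∸_; _/_; _≤_; _<_; z≤n; s≤s; _≤?_)
open import Data.Nat.Properties
  using (≤-trans; ≤-antisym; ≰⇒>; <⇒≤; <-irrefl; +-monoʳ-≤; +-monoʳ-<; +-identityʳ; *-comm;
         *-cancelʳ-≤; ∸-+-assoc; m+[n∸m]≡n; m<n⇒0<n∸m; module ≤-Reasoning)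
open import Data.Nat.DivMod using (m*n/n≡m)
open import Data.Nat.Divisibility using (_∣_; divides)
open import Data.Fin using (Fin; zero; suc; splitAt; join; _≟_)
open import Data.Fin.Properties using (injective⇒≤; join-splitAt; suc-injective)
open import Data.Fin.Subset using (Subset; inside; outside; ⊤; ⊥; ∣_∣; _∈_)
open import Data.Fin.Subset.Properties using (∣⊤∣≡n; ∣⊥∣≡0; ∈⊤)
open import Data.Vec using (_∷_; here; there)
open import Data.Vec.Functional as Vector using (Vector; _++_)
open import Data.Product using (Σ; ∃; _×_; _,_; proj₁; proj₂)
open import Data.Sum using (_⊎_; inj₁; inj₂; [_,_])
open import Data.Empty using (⊥-elim)
open import Relation.Nullary using (¬_; yes; no)
open import Relation.Binary.PropositionalEquality as ≡
  using (_≡_; _≢_; refl; trans; cong; subst; module ≡-Reasoning)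
open import Function using (_∘_)
open import Function.Definitions using (Injective)

∃-subset-of-size : ∀ n k → k ≤ n → Σ (Subset n) λ S → ∣ S ∣ ≡ k
∃-subset-of-size n       zero    _       = ⊥ , ∣⊥∣≡0 n
∃-subset-of-size (suc n) (suc k) (s≤s k≤n) with ∃-subset-of-size n k k≤n
... | S , ∣S∣≡k = inside ∷ S , cong suc ∣S∣≡k

∃-subset-of-size-∋ : ∀ n (v : Fin n) k → 1 ≤ k → k ≤ n → Σ (Subset n) λ S → ∣ S ∣ ≡ k × v ∈ S
∃-subset-of-size-∋ (suc n) zero (suc k) _ (s≤s k≤n) with ∃-subset-of-size n k k≤n
... | S , ∣S∣≡k = inside ∷ S , cong suc ∣S∣≡k , here
∃-subset-of-size-∋ (suc n) (suc v) k 1≤k k≤1+n with k ≤? n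
... | yes k≤n with ∃-subset-of-size-∋ n v k 1≤k k≤n
...   | S , ∣S∣≡k , v∈S = outside ∷ S , ∣S∣≡k , there v∈S
∃-subset-of-size-∋ (suc n) (suc v) k 1≤k k≤1+n | no k≰n =
  ⊤ , trans (∣⊤∣≡n (suc n)) (≤-antisym (≰⇒> k≰n) k≤1+n) , ∈⊤

∃-∈ : ∀ {n} (S : Subset n) → 1 ≤ ∣ S ∣ → ∃ λ u → u ∈ S
∃-∈ (inside  ∷ S) _ = zero , here
∃-∈ (outside ∷ S) 1≤∣S∣ with ∃-∈ S 1≤∣S∣
... | u , u∈S = suc u , there u∈S

∃-∈-≢ : ∀ {n} (S : Subset n) {v} → v ∈ S → 2 ≤ ∣ S ∣ → ∃ λ u → u ∈ S × u ≢ v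
∃-∈-≢ (inside ∷ S) here (s≤s 1≤∣S∣) with ∃-∈ S 1≤∣S∣
... | u , u∈S = suc u , there u∈S , λ ()
∃-∈-≢ (inside ∷ S) (there _) _ = zero , here , λ ()
∃-∈-≢ (outside ∷ S) (there v∈S) 2≤∣S∣ with ∃-∈-≢ S v∈S 2≤∣S∣
... | u , u∈S , u≢v = suc u , there u∈S , λ eq → u≢v (suc-injective eq)

Reach-step-from : ∀ {n} {R : Fin n → Fin n → Set} {u v} → u ≢ v → Reach R v u → ∃ (R v)
Reach-step-from u≢v here           = ⊥-elim (u≢v refl)
Reach-step-from _   (step {v = w} r _) = w , r

∷-injective : ∀ {A : Set} {m} {x : A} {f : Vector A m} →
  (∀ i → x ≢ f i) → Injective _≡_ _≡_ f → Injective _≡_ _≡_ (x Vector.∷ f)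
∷-injective x∉f f-inj {zero} {zero} _  = refl
∷-injective x∉f f-inj {zero} {suc j} eq = ⊥-elim (x∉f j eq)
∷-injective x∉f f-inj {suc i} {zero} eq = ⊥-elim (x∉f i (≡.sym eq))
∷-injective x∉f f-inj {suc i} {suc j} eq = cong suc (f-inj eq)

++-injective : ∀ {A : Set} {a b} {f : Vector A a} {g : Vector A b} →
  Injective _≡_ _≡_ f → Injective _≡_ _≡_ g → (∀ i j → f i ≢ g j) →
  Injective _≡_ _≡_ (f ++ g)
++-injective {a = a} {b} {f} {g} f-inj g-inj f≢g {i} {j} eq = begin
  i                      ≡⟨ join-splitAt a b i ⟨
  join a b (splitAt a i) ≡⟨ cong (join a b) ([f,g]-injective (splitAt a i) (splitAt a j) eq) ⟩
  join a b (splitAt a j) ≡⟨ join-splitAt a b j ⟩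
  j                      ∎
  where
  open ≡-Reasoning
  [f,g]-injective : ∀ x y → [ f , g ] x ≡ [ f , g ] y → x ≡ y
  [f,g]-injective (inj₁ x) (inj₁ y) e = cong inj₁ (f-inj e)
  [f,g]-injective (inj₁ x) (inj₂ y) e = ⊥-elim (f≢g x y e)
  [f,g]-injective (inj₂ x) (inj₁ y) e = ⊥-elim (f≢g y x (≡.sym e))
  [f,g]-injective (inj₂ x) (inj₂ y) e = cong inj₂ (g-inj e)

Kappa_k≥⇒Lambda_k≥ : ∀ {n} {G : Graph n} {k t} → Kappa_k≥ G k t → Lambda_k≥ G k t
Kappa_k≥⇒Lambda_k≥ κ≥t t≢0 with κ≥t t≢0
... | connected , trees = connected , λ S ∣S∣≡k →
  let T , internallyDisjoint = trees S ∣S∣≡k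
  in  T , λ i j i≢j → proj₁ (internallyDisjoint i j i≢j)

DegreeAtLeast : ∀ {n} → Graph n → Fin n → ℕ → Set
DegreeAtLeast {n} G v d = Σ (Fin d → Fin n) λ f → Injective _≡_ _≡_ f × (∀ i → G v (f i))

LambdaS≥⇒DegreeAtLeast : ∀ {n} {G : Graph n} {S t u v} →
  u ∈ S → v ∈ S → u ≢ v → LambdaS≥ G S t → DegreeAtLeast G v t
LambdaS≥⇒DegreeAtLeast {n} {t = t} {v = v} u∈S v∈S u≢v (T , edgeDisjoint) =
  far-end , far-end-injective , λ i → inG (tree (T i)) (proj₂ (first-edge i))
  where
  first-edge : ∀ i → ∃ (E (tree (T i)) v)
  first-edge i = Reach-step-from u≢v
    (proj₁ (isTree (T i)) (spans (T i) v∈S) (spans (T i) u∈S))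
  far-end : Fin t → Fin n
  far-end i = proj₁ (first-edge i)
  far-end-injective : Injective _≡_ _≡_ far-end
  far-end-injective {i} {j} eq with i ≟ j
  ... | yes i≡j = i≡j
  ... | no  i≢j = ⊥-elim (edgeDisjoint i j i≢j v (far-end i) (proj₂ (first-edge i))
                    (subst (E (tree (T j)) v) (≡.sym eq) (proj₂ (first-edge j))))

degree[M]+degree[Kn∖M]<n : ∀ {n} (M : EdgeSet n) {v d t} →
  DegreeAtLeast (InM M) v d → DegreeAtLeast (KnMinus n M) v t → d + t < n
degree[M]+degree[Kn∖M]<n M {v} (f , f-inj , vMf) (g , g-inj , vGg) =
  injective⇒≤ (∷-injective (v∉[f,g] ∘ splitAt _) (++-injective f-inj g-inj f≢g))
  where
  v∉[f,g] : ∀ x → v ≢ [ f , g ] x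
  v∉[f,g] (inj₁ a) = proj₁ (vMf a)
  v∉[f,g] (inj₂ b) = proj₁ (vGg b)
  f≢g : ∀ a b → f a ≢ g b
  f≢g a b fa≡gb = proj₂ (vGg b) (subst (λ x → M v x ⊎ M x v) fa≡gb (proj₂ (vMf a)))

-- Lambda_k≥ G k 0 holds vacuously, hence t ≢ 0.
Lambda_k≥[Kn∖M]⇒Δ+t<n : ∀ {n} (M : EdgeSet n) {k d t} → 2 ≤ k → k ≤ n →
  MaxDegAtLeast M d → t ≢ 0 → Lambda_k≥ (KnMinus n M) k t → d + t < n
Lambda_k≥[Kn∖M]⇒Δ+t<n {n} M {k} 2≤k k≤n (v , degree[M]≥d) t≢0 λ≥t
  with ∃-subset-of-size-∋ n v k (≤-trans (s≤s z≤n) 2≤k) k≤n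
... | S , ∣S∣≡k , v∈S with ∃-∈-≢ S v∈S (subst (2 ≤_) (≡.sym ∣S∣≡k) 2≤k)
...   | u , u∈S , u≢v = degree[M]+degree[Kn∖M]<n M degree[M]≥d
  (LambdaS≥⇒DegreeAtLeast u∈S v∈S u≢v (proj₂ (λ≥t t≢0) S ∣S∣≡k))

m+1<m*2 : ∀ m → 2 ≤ m → m + 1 < m * 2
m+1<m*2 m 2≤m = begin-strict
  m + 1       <⟨ +-monoʳ-< m (s≤s (s≤s z≤n)) ⟩
  m + 2       ≤⟨ +-monoʳ-≤ m 2≤m ⟩
  m + m       ≡⟨ cong (m +_) (+-identityʳ m) ⟨
  m + (m + 0) ≡⟨ *-comm 2 m ⟩
  m * 2       ∎
  where open ≤-Reasoning

corollary1 : (n k : ℕ) → 4 ≤ k → k ≤ n → 2 ∣ k → (M : EdgeSet n)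
    → MaxDegAtLeast M (k / 2 + 1)
    → (∀ (t : ℕ) → Kappa_k≥ (KnMinus n M) k t → Lambda_k≥ (KnMinus n M) k t)
      × ¬ Lambda_k≥ (KnMinus n M) k (n ∸ k / 2 ∸ 1)
corollary1 n k 4≤k k≤n (divides h refl) M Δ≥ rewrite m*n/n≡m h 2 ⦃ _ ⦄ =
  (λ _ → Kappa_k≥⇒Lambda_k≥) ,
  λ λ≥t → <-irrefl d+t≡n (Lambda_k≥[Kn∖M]⇒Δ+t<n M 2≤k k≤n Δ≥ t≢0 λ≥t)
  where
  d<n : h + 1 < n
  d<n = ≤-trans (m+1<m*2 h (*-cancelʳ-≤ 2 h 2 4≤k)) k≤n
  t≡n∸d : n ∸ h ∸ 1 ≡ n ∸ (h + 1)
  t≡n∸d = ∸-+-assoc n h 1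
  d+t≡n : h + 1 + (n ∸ h ∸ 1) ≡ n
  d+t≡n = trans (cong (h + 1 +_) t≡n∸d) (m+[n∸m]≡n (<⇒≤ d<n))
  t≢0 : n ∸ h ∸ 1 ≢ 0
  t≢0 t≡0 = <-irrefl (≡.sym (trans (≡.sym t≡n∸d) t≡0)) (m<n⇒0<n∸m d<n)
  2≤k : 2 ≤ h * 2
  2≤k = ≤-trans (s≤s (s≤s z≤n)) 4≤k
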